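{- Let $X$ be a finite temporal transit, $S\subseteq X$ archival, $x\in S$, and $w\in X$ with $xBw$. Then $w\in S$.
   Context: A temporal transit is a structure $(X,R^{\triangleleft},R^{\triangleright},\le)$ where $\le$ is a partial order equal to the reflexive closure $R^{\triangleright}\cup\Delta_X$ of $R^{\triangleright}$, and $R^{\triangleleft}$ is the converse of $R^{\triangleright}$. $\mathrm{Refl}(X)=\{v:vR^{\triangleright}v\}$. A subset $S$ is archival if for all $x,z$: if $x\notin S$, $z\in S$ and $zR^{\triangleleft}x$, then $R^{\triangleleft}[z]\cap{\uparrow}x\cap S\neq\emptyset$. On a finite temporal transit, $xBw$ means $w\le x$ and $(w,x]\cap\mathrm{Refl}(X)=\emptyset$, where $(w,x]=\{v:w<v\le x\}$. -}

module Defs where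

open import Data.Nat using (ℕ)
open import Data.Fin using (Fin)
open import Data.Bool using (Bool; T)
open import Data.Fin.Subset using (Subset; _∈_; _∉_)
open import Data.Product using (_×_; ∃-syntax)
open import Data.Sum using (_⊎_)
open import Relation.Nullary using (¬_)
open import Relation.Binary.PropositionalEquality using (_≡_; _≢_)

-- A finite temporal transit on the carrier Fin n is given by the relation
-- R▷ (as a Boolean-valued, i.e. finite, relation).
record TemporalTransit (n : ℕ) : Set where
  field
    rel▷ : Fin n → Fin n → Bool

  _R▷_ : Fin n → Fin n → Set
  x R▷ y = T (rel▷ x y)

  _R◁_ : Fin n → Fin n → Set
  x R◁ y = y R▷ x

  _≤_ : Fin n → Fin n → Set
  x ≤ y = x R▷ y ⊎ x ≡ y

  _<_ : Fin n → Fin n → Set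
  x < y = x ≤ y × x ≢ y

  Refl : Fin n → Set
  Refl v = v R▷ v

  _B_ : Fin n → Fin n → Set
  x B w = w ≤ x × (∀ v → w < v → v ≤ x → ¬ Refl v)

  Archival : Subset n → Set
  Archival S = ∀ x z → x ∉ S → z ∈ S → z R◁ x →
               ∃[ y ] (z R◁ y × x ≤ y × y ∈ S)

  field
    -- ≤ is a partial order (reflexivity holds by construction)
    ≤-antisym : ∀ x y → x ≤ y → y ≤ x → x ≡ y
    ≤-trans   : ∀ x y z → x ≤ y → y ≤ z → x ≤ z

-- If w ∉ S, archivality lets us step from any y ∈ S above w to some y′ ∈ S
-- with w ≤ y′ R▷ y.  Either y′ = y, so y is reflexive, or y′ is strictly
-- below y and we repeat; since Fin n is finite, the strict order is
-- well-founded and the descent ends in a reflexive point of (w, y].  For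
-- y = x this contradicts x B w.
module Submission where

open import Defs
open import Data.Nat using (ℕ)
open import Data.Fin using (Fin; _≟_)
open import Data.Fin.Subset using (Subset; _∈_; _∉_)
open import Data.Fin.Subset.Properties using (_∈?_)
open import Data.Fin.Induction using (po-wellFounded)
open import Data.Empty using (⊥-elim)
open import Data.Product using (_,_; ∃-syntax; _×_)
open import Data.Sum using (_⊎_; inj₁; inj₂)
open import Induction.WellFounded using (WellFounded; Acc; acc)
open import Relation.Nullary using (yes; no)
open import Relation.Binary.Structures using (IsPartialOrder)
open import Relation.Binary.PropositionalEquality
  using (_≡_; _≢_; refl; isEquivalence)

module _ {n : ℕ} (X : TemporalTransit n) where
  open TemporalTransit X

  ≤-isPartialOrder : IsPartialOrder _≡_ _≤_
  ≤-isPartialOrder = record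
    { isPreorder = record
      { isEquivalence = isEquivalence
      ; reflexive     = inj₂
      ; trans         = λ {x} {y} {z} → ≤-trans x y z
      }
    ; antisym = λ {x} {y} → ≤-antisym x y
    }

  <-wellFounded : WellFounded _<_
  <-wellFounded = po-wellFounded ≤-isPartialOrder

  <⇒R▷ : ∀ {x y} → x < y → x R▷ y
  <⇒R▷ (inj₁ xR▷y , _) = xR▷y
  <⇒R▷ (inj₂ x≡y  , x≢y) = ⊥-elim (x≢y x≡y)

  ∈-∉⇒≢ : ∀ (S : Subset n) {x y} → x ∈ S → y ∉ S → y ≢ x
  ∈-∉⇒≢ S x∈S y∉S refl = y∉S x∈S

  module _ {S : Subset n} (archival : Archival S) {w : Fin n} (w∉S : w ∉ S) where

    archival-step : ∀ {y} → y ∈ S → w < y →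
                    Refl y ⊎ ∃[ y′ ] (y′ < y × w < y′ × y′ ∈ S)
    archival-step {y} y∈S w<y with archival w y w∉S y∈S (<⇒R▷ w<y)
    ... | y′ , y′R▷y , w≤y′ , y′∈S with y′ ≟ y
    ...   | yes refl = inj₁ y′R▷y
    ...   | no y′≢y  = inj₂ (y′ , (inj₁ y′R▷y , y′≢y) , (w≤y′ , ∈-∉⇒≢ S y′∈S w∉S) , y′∈S)

    archival-reflexive-above : ∀ {y} → y ∈ S → w < y →
                               ∃[ v ] (w < v × v ≤ y × Refl v)
    archival-reflexive-above {y} = go y (<-wellFounded y)
      where
      go : ∀ y → Acc _<_ y → y ∈ S → w < y → ∃[ v ] (w < v × v ≤ y × Refl v)
      go y (acc below) y∈S w<y with archival-step y∈S w<y
      ... | inj₁ refl-y = y , w<y , inj₂ refl , refl-y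
      ... | inj₂ (y′ , y′<y@(y′≤y , _) , w<y′ , y′∈S)
            with go y′ (below y′<y) y′∈S w<y′
      ...   | v , w<v , v≤y′ , refl-v = v , w<v , ≤-trans v y′ y v≤y′ y′≤y , refl-v

lemma4p6 : (n : ℕ) (X : TemporalTransit n) (S : Subset n) (x w : Fin n) →
    TemporalTransit.Archival X S → x ∈ S → TemporalTransit._B_ X x w → w ∈ S
lemma4p6 n X S x w archival x∈S (w≤x , gap-irreflexive) with w ∈? S
... | yes w∈S = w∈S
... | no w∉S with archival-reflexive-above X archival w∉S x∈S (w≤x , ∈-∉⇒≢ X S x∈S w∉S)
...   | v , w<v , v≤x , refl-v = ⊥-elim (gap-irreflexive v w<v v≤x refl-v)
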